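{- Let $\mathcal{F}$ be a spreading linear triple system on a vertex set $V$ with $|V|=n>5$. Let $G$ be its shadow and $\overline{G}$ the complement of $G$ on $V$. For a triple $T\in\mathcal{F}$ let $\mathrm{Val}(T)$ be the number of vertices outside $T$ adjacent in $G$ to exactly one vertex of $T$. Let $\mathcal{G}$ be the graph whose vertices are the triples of $\mathcal{F}$, where $T$ and $T'$ are adjacent if there is a pair of vertices in $T$ and a pair of vertices in $T'$ whose four vertices span a 4-cycle in $\overline{G}$. If $T$ and $T'$ are adjacent in $\mathcal{G}$, then $\mathrm{Val}(T)+\mathrm{Val}(T')\leq n$.
   Context: A linear triple system $\mathcal{F}$ on $V$ is a family of 3-element subsets (triples) of $V$ any two of which share at most one element. Its shadow $G=G(\mathcal{F})$ is the graph on $V$ whose edges are the pairs $xy$ contained in some triple of $\mathcal{F}$. For $V'\subseteq V$, $N(V')$ is the set of all $z\in V\setminus V'$ for which there exist distinct $x,y\in V'$ with $\{x,y,z\}\in\mathcal{F}$; the closure $\mathrm{cl}(V')$ is the smallest $W\supseteq V'$ with $N(W)=\emptyset$. A subset $V'$ is nontrivial if $|V'|\geq3$ and $V'\notin\mathcal{F}$. $\mathcal{F}$ is spreading if $\mathrm{cl}(V')=V$ for every nontrivial $V'\subseteq V$. -}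

module Defs where

open import Data.Nat using (ℕ; _≤_; _<_)
open import Data.Fin using (Fin; _≟_)
open import Data.Fin.Subset using (Subset; _∈_; _∉_; _⊆_; ⊤; _∩_; ∣_∣; Side; inside; outside)
open import Data.Fin.Subset.Properties using (_∈?_)
open import Data.List using (List)
open import Data.List.Relation.Unary.Any using (Any; any?)
open import Data.List.Membership.Propositional using () renaming (_∈_ to _∈ₗ_; _∉_ to _∉ₗ_)
open import Data.Product using (_×_; ∃; Σ-syntax; ∃-syntax)
open import Data.Sum using (_⊎_)
open import Data.Vec using (tabulate)
open import Relation.Nullary using (¬_; Dec; yes; no; _×-dec_; ¬?)
open import Relation.Binary.PropositionalEquality using (_≡_; _≢_)
open import Data.Nat using () renaming (_≟_ to _≟ℕ_)

-- Vertex set V = Fin n.  A triple system is a finite list of subsets of V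
-- (repetitions are irrelevant: all notions below only use membership).
Family : ℕ → Set
Family n = List (Subset n)

module _ {n : ℕ} where

  IsTripleSystem : Family n → Set
  IsTripleSystem F = ∀ T → T ∈ₗ F → ∣ T ∣ ≡ 3

  IsLinear : Family n → Set
  IsLinear F = IsTripleSystem F ×
    (∀ T T' → T ∈ₗ F → T' ∈ₗ F → T ≢ T' → ∣ T ∩ T' ∣ ≤ 1)

  ShadowAdj : Family n → Fin n → Fin n → Set
  ShadowAdj F x y = (x ≢ y) × Any (λ T → x ∈ T × y ∈ T) F

  shadowAdj? : (F : Family n) → ∀ x y → Dec (ShadowAdj F x y)
  shadowAdj? F x y = ¬? (x ≟ y) ×-dec any? (λ T → (x ∈? T) ×-dec (y ∈? T)) F

  CoAdj : Family n → Fin n → Fin n → Set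
  CoAdj F x y = (x ≢ y) × ¬ ShadowAdj F x y

  -- W has empty neighbourhood N(W): whenever distinct x,y ∈ W lie in a
  -- triple {x,y,z} ∈ F, also z ∈ W
  NClosed : Family n → Subset n → Set
  NClosed F W = ∀ x y z → x ∈ W → y ∈ W → x ≢ y → z ∉ W →
    ¬ Any (λ T → x ∈ T × y ∈ T × z ∈ T) F

  -- cl(V') = V: the smallest superset W of V' with N(W) = ∅ is all of V,
  -- i.e. every such superset is all of V
  ClosureIsAll : Family n → Subset n → Set
  ClosureIsAll F V' = ∀ W → V' ⊆ W → NClosed F W → W ≡ ⊤

  Nontrivial : Family n → Subset n → Set
  Nontrivial F V' = (3 ≤ ∣ V' ∣) × (V' ∉ₗ F)

  Spreading : Family n → Set
  Spreading F = ∀ V' → Nontrivial F V' → ClosureIsAll F V'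

  fromDec : ∀ {P : Set} → Dec P → Side
  fromDec (yes _) = inside
  fromDec (no _)  = outside

  nbhd : Family n → Fin n → Subset n
  nbhd F z = tabulate (λ x → fromDec (shadowAdj? F z x))

  ValSet : Family n → Subset n → Subset n
  ValSet F T = tabulate (λ z → fromDec (¬? (z ∈? T) ×-dec (∣ T ∩ nbhd F z ∣ ≟ℕ 1)))

  Val : Family n → Subset n → ℕ
  Val F T = ∣ ValSet F T ∣

  -- a, b, c, d span a 4-cycle in the complement graph (three possible
  -- cyclic orders of four vertices)
  Cycle4 : Family n → Fin n → Fin n → Fin n → Fin n → Set
  Cycle4 F a b c d =
      (CoAdj F a b × CoAdj F b c × CoAdj F c d × CoAdj F d a)
    ⊎ (CoAdj F a b × CoAdj F b d × CoAdj F d c × CoAdj F c a)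
    ⊎ (CoAdj F a c × CoAdj F c b × CoAdj F b d × CoAdj F d a)

  AllDistinct4 : Fin n → Fin n → Fin n → Fin n → Set
  AllDistinct4 a b c d = a ≢ b × a ≢ c × a ≢ d × b ≢ c × b ≢ d × c ≢ d

  TripleGraphAdj : Family n → Subset n → Subset n → Set
  TripleGraphAdj F T T' = T ≢ T' ×
    (∃[ a ] ∃[ b ] ∃[ c ] ∃[ d ]
      (a ∈ T × b ∈ T × c ∈ T' × d ∈ T' × AllDistinct4 a b c d × Cycle4 F a b c d))

module Submission where

-- Let z be a vertex counted by both Val(T) and Val(T').  Being
-- outside T and adjacent to exactly one vertex of T, z misses one of any two
-- vertices a, b of T; likewise it misses one of c, d in T'.  If a, b, c, d
-- span a 4-cycle of the complement graph, the edge ab of the shadow forces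
-- the cycle to be a-c-b-d-a, so every vertex of {a,b} is non-adjacent to
-- every vertex of {c,d}.  Hence z and the two missed vertices form an
-- independent triple of the shadow.  But in a spreading system on more than
-- three vertices every independent set of size at least three is closed and
-- nontrivial, hence all of V — impossible for a 3-set.  So the sets counted
-- by Val(T) and Val(T') are disjoint, and their sizes add up to at most n.

open import Defs
open import Data.Nat using (ℕ; _∸_; _<_; _≤_; _+_; z≤n; s≤s)
open import Data.Nat.Properties
  using (≤-trans; ≤-reflexive; +-suc; +-monoʳ-≤; +-monoˡ-≤; <⇒≱; m≤o∸n⇒m+n≤o)
open import Data.Fin using (Fin)
open import Data.Fin.Subset
  using (Subset; ∣_∣; ⁅_⁆; _∪_; _∩_; ⊤; inside; outside)
  renaming (_∈_ to _∈ₛ_; _∉_ to _∉ₛ_)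
open import Data.Fin.Subset.Properties
  using ( x∈p∧x≢y⇒x∈p-y; x∈p⇒∣p-x∣<∣p∣; x∈p∪q⁺; x∈p∪q⁻; x∈⁅x⁆; x∈⁅y⁆⇒x≡y
        ; ∣⁅x⁆∣≡1; ∣⊤∣≡n; ∣p∣≤n; ∣p∣≤∣x∷p∣; ∣∁p∣≡n∸∣p∣; p⊆q⇒∣p∣≤∣q∣
        ; x∉p⇒x∈∁p; x∈p∩q⁺)
open import Data.List.Membership.Propositional using (_∈_)
open import Data.List.Relation.Unary.Any as Any using (Any)
open import Data.Vec using (_∷_; []; tabulate)
open import Data.Vec.Properties using (lookup∘tabulate; []=⇒lookup; lookup⇒[]=)
open import Data.Product using (_×_; _,_; proj₁; proj₂)
open import Function using (_∘_)
open import Data.Sum using (_⊎_; inj₁; inj₂)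
open import Data.Empty using (⊥; ⊥-elim)
open import Relation.Nullary using (¬_; Dec; yes; no)
open import Relation.Binary.PropositionalEquality
  using (_≡_; _≢_; refl; sym; trans; cong; cong₂; subst)

∣p∪q∣≤∣p∣+∣q∣ : ∀ {n} (p q : Subset n) → ∣ p ∪ q ∣ ≤ ∣ p ∣ + ∣ q ∣
∣p∪q∣≤∣p∣+∣q∣ []            []            = z≤n
∣p∪q∣≤∣p∣+∣q∣ (inside ∷ p)  (s ∷ q)       =
  s≤s (≤-trans (∣p∪q∣≤∣p∣+∣q∣ p q) (+-monoʳ-≤ ∣ p ∣ (∣p∣≤∣x∷p∣ s q)))
∣p∪q∣≤∣p∣+∣q∣ (outside ∷ p) (inside ∷ q)  =
  ≤-trans (s≤s (∣p∪q∣≤∣p∣+∣q∣ p q)) (≤-reflexive (sym (+-suc ∣ p ∣ ∣ q ∣)))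
∣p∪q∣≤∣p∣+∣q∣ (outside ∷ p) (outside ∷ q) = ∣p∪q∣≤∣p∣+∣q∣ p q

-- Two disjoint subsets of Fin n have at most n elements together:
-- p lies inside the complement of q.
disjoint⇒∣p∣+∣q∣≤n : ∀ {n} (p q : Subset n) →
  (∀ z → z ∈ₛ p → z ∉ₛ q) → ∣ p ∣ + ∣ q ∣ ≤ n
disjoint⇒∣p∣+∣q∣≤n {n} p q disj = m≤o∸n⇒m+n≤o ∣ p ∣ (∣p∣≤n q) ∣p∣≤n∸∣q∣
  where
  ∣p∣≤n∸∣q∣ : ∣ p ∣ ≤ n ∸ ∣ q ∣
  ∣p∣≤n∸∣q∣ = subst (∣ p ∣ ≤_) (∣∁p∣≡n∸∣p∣ q)
                (p⊆q⇒∣p∣≤∣q∣ (λ {z} z∈p → x∉p⇒x∈∁p (disj z z∈p)))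

one≤∣p∣ : ∀ {n} {x : Fin n} {p : Subset n} → x ∈ₛ p → 1 ≤ ∣ p ∣
one≤∣p∣ x∈p = ≤-trans (s≤s z≤n) (x∈p⇒∣p-x∣<∣p∣ x∈p)

two≤∣p∣ : ∀ {n} {x y : Fin n} {p : Subset n} →
  x ∈ₛ p → y ∈ₛ p → x ≢ y → 2 ≤ ∣ p ∣
two≤∣p∣ x∈p y∈p x≢y =
  ≤-trans (s≤s (one≤∣p∣ (x∈p∧x≢y⇒x∈p-y y∈p (x≢y ∘ sym)))) (x∈p⇒∣p-x∣<∣p∣ x∈p)

three≤∣p∣ : ∀ {n} {x y w : Fin n} {p : Subset n} →
  x ∈ₛ p → y ∈ₛ p → w ∈ₛ p → x ≢ y → x ≢ w → y ≢ w → 3 ≤ ∣ p ∣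
three≤∣p∣ x∈p y∈p w∈p x≢y x≢w y≢w =
  ≤-trans (s≤s (two≤∣p∣ (x∈p∧x≢y⇒x∈p-y y∈p (x≢y ∘ sym))
                        (x∈p∧x≢y⇒x∈p-y w∈p (x≢w ∘ sym)) y≢w))
          (x∈p⇒∣p-x∣<∣p∣ x∈p)

tripleSet : ∀ {n} → Fin n → Fin n → Fin n → Subset n
tripleSet x y w = (⁅ x ⁆ ∪ ⁅ y ⁆) ∪ ⁅ w ⁆

module _ {n : ℕ} {x y w : Fin n} where

  x∈tripleSet : x ∈ₛ tripleSet x y w
  x∈tripleSet = x∈p∪q⁺ (inj₁ (x∈p∪q⁺ (inj₁ (x∈⁅x⁆ x))))

  y∈tripleSet : y ∈ₛ tripleSet x y w
  y∈tripleSet = x∈p∪q⁺ (inj₁ (x∈p∪q⁺ (inj₂ (x∈⁅x⁆ y))))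

  w∈tripleSet : w ∈ₛ tripleSet x y w
  w∈tripleSet = x∈p∪q⁺ (inj₂ (x∈⁅x⁆ w))

  ∈tripleSet⁻ : ∀ {u} → u ∈ₛ tripleSet x y w → u ≡ x ⊎ u ≡ y ⊎ u ≡ w
  ∈tripleSet⁻ u∈ with x∈p∪q⁻ (⁅ x ⁆ ∪ ⁅ y ⁆) ⁅ w ⁆ u∈
  ... | inj₂ u∈w = inj₂ (inj₂ (x∈⁅y⁆⇒x≡y w u∈w))
  ... | inj₁ u∈xy with x∈p∪q⁻ ⁅ x ⁆ ⁅ y ⁆ u∈xy
  ...   | inj₁ u∈x = inj₁ (x∈⁅y⁆⇒x≡y x u∈x)
  ...   | inj₂ u∈y = inj₂ (inj₁ (x∈⁅y⁆⇒x≡y y u∈y))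

  ∣tripleSet∣≤3 : ∣ tripleSet x y w ∣ ≤ 3
  ∣tripleSet∣≤3 = ≤-trans (∣p∪q∣≤∣p∣+∣q∣ (⁅ x ⁆ ∪ ⁅ y ⁆) ⁅ w ⁆)
    (subst (λ k → ∣ ⁅ x ⁆ ∪ ⁅ y ⁆ ∣ + k ≤ 3) (sym (∣⁅x⁆∣≡1 w))
      (+-monoˡ-≤ 1 (≤-trans (∣p∪q∣≤∣p∣+∣q∣ ⁅ x ⁆ ⁅ y ⁆)
        (≤-reflexive (cong₂ _+_ (∣⁅x⁆∣≡1 x) (∣⁅x⁆∣≡1 y))))))

∈-tabulate-fromDec⁻ : ∀ {n} {P : Fin n → Set} (P? : ∀ x → Dec (P x)) x →
  x ∈ₛ tabulate (λ y → fromDec {n} (P? y)) → P x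
∈-tabulate-fromDec⁻ {n} P? x x∈ = decided (P? x) inside-at-x
  where
  inside-at-x : fromDec {n} (P? x) ≡ inside
  inside-at-x = trans (sym (lookup∘tabulate (λ y → fromDec {n} (P? y)) x)) ([]=⇒lookup x∈)
  decided : ∀ {Q : Set} (Q? : Dec Q) → fromDec {n} Q? ≡ inside → Q
  decided (yes q) _ = q
  decided (no _) ()

∈-tabulate-fromDec⁺ : ∀ {n} {P : Fin n → Set} (P? : ∀ x → Dec (P x)) x →
  P x → x ∈ₛ tabulate (λ y → fromDec {n} (P? y))
∈-tabulate-fromDec⁺ {n} {P} P? x px =
  lookup⇒[]= x _ (trans (lookup∘tabulate (λ y → fromDec {n} (P? y)) x) (inside-if px))
  where
  inside-if : P x → fromDec {n} (P? x) ≡ inside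
  inside-if px with P? x
  ... | yes _  = refl
  ... | no ¬px = ⊥-elim (¬px px)

module _ {n : ℕ} (F : Family n) where

  shadow-sym : ∀ {x y} → ShadowAdj F x y → ShadowAdj F y x
  shadow-sym (x≢y , x,y∈T) = x≢y ∘ sym , Any.map (λ (x∈T , y∈T) → y∈T , x∈T) x,y∈T

  triple⇒shadow : ∀ {T x y} → T ∈ F → x ∈ₛ T → y ∈ₛ T → x ≢ y → ShadowAdj F x y
  triple⇒shadow T∈F x∈T y∈T x≢y = x≢y , Any.map (λ { refl → x∈T , y∈T }) T∈F

  Independent : Subset n → Set
  Independent W = ∀ u v → u ∈ₛ W → v ∈ₛ W → u ≢ v → ¬ ShadowAdj F u v

  -- In a spreading system an independent set W of size at least three is
  -- all of V: it is not a triple (two of its members are non-adjacent) and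
  -- it has empty neighbourhood (no two of its members share a triple).
  independent⇒⊤ : Spreading F → ∀ {W x y} → Independent W →
    x ∈ₛ W → y ∈ₛ W → x ≢ y → 3 ≤ ∣ W ∣ → W ≡ ⊤
  independent⇒⊤ spreading {W} indep x∈W y∈W x≢y 3≤∣W∣ =
    spreading W (3≤∣W∣ , W∉F) W (λ u∈W → u∈W) closed
    where
    W∉F : ¬ (W ∈ F)
    W∉F W∈F = indep _ _ x∈W y∈W x≢y (triple⇒shadow W∈F x∈W y∈W x≢y)
    closed : NClosed F W
    closed u v _ u∈W v∈W u≢v _ u,v,z∈T =
      indep u v u∈W v∈W u≢v (u≢v , Any.map (λ (u∈T , v∈T , _) → u∈T , v∈T) u,v,z∈T)

  no-independent-triple : Spreading F → 3 < n → ∀ {x y w} →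
    x ≢ y → x ≢ w → y ≢ w →
    ¬ ShadowAdj F x y → ¬ ShadowAdj F x w → ¬ ShadowAdj F y w → ⊥
  no-independent-triple spreading 3<n {x} {y} {w} x≢y x≢w y≢w ¬xy ¬xw ¬yw =
    <⇒≱ 3<n (subst (_≤ 3) ∣W∣≡n (∣tripleSet∣≤3 {x = x} {y} {w}))
    where
    W : Subset n
    W = tripleSet x y w
    indep : Independent W
    indep u v u∈W v∈W u≢v with ∈tripleSet⁻ u∈W | ∈tripleSet⁻ v∈W
    ... | inj₁ refl        | inj₂ (inj₁ refl) = ¬xy
    ... | inj₁ refl        | inj₂ (inj₂ refl) = ¬xw
    ... | inj₂ (inj₁ refl) | inj₂ (inj₂ refl) = ¬yw
    ... | inj₂ (inj₁ refl) | inj₁ refl        = ¬xy ∘ shadow-sym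
    ... | inj₂ (inj₂ refl) | inj₁ refl        = ¬xw ∘ shadow-sym
    ... | inj₂ (inj₂ refl) | inj₂ (inj₁ refl) = ¬yw ∘ shadow-sym
    ... | inj₁ refl        | inj₁ refl        = ⊥-elim (u≢v refl)
    ... | inj₂ (inj₁ refl) | inj₂ (inj₁ refl) = ⊥-elim (u≢v refl)
    ... | inj₂ (inj₂ refl) | inj₂ (inj₂ refl) = ⊥-elim (u≢v refl)
    ∣W∣≡n : ∣ W ∣ ≡ n
    ∣W∣≡n = trans (cong ∣_∣ (independent⇒⊤ spreading indep x∈tripleSet y∈tripleSet x≢y
                              (three≤∣p∣ x∈tripleSet y∈tripleSet w∈tripleSet x≢y x≢w y≢w)))
                  (∣⊤∣≡n n)

module _ {n : ℕ} (F : Family n) where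

  valSet-outside : ∀ {T z} → z ∈ₛ ValSet F T → z ∉ₛ T
  valSet-outside {T} {z} z∈Val = proj₁ (∈-tabulate-fromDec⁻ _ z z∈Val)

  valSet-misses : ∀ {T z a b} → z ∈ₛ ValSet F T → a ∈ₛ T → b ∈ₛ T → a ≢ b →
    ¬ ShadowAdj F z a ⊎ ¬ ShadowAdj F z b
  valSet-misses {T} {z} {a} {b} z∈Val a∈T b∈T a≢b
    with shadowAdj? F z a | shadowAdj? F z b
  ... | no ¬za | _      = inj₁ ¬za
  ... | yes _  | no ¬zb = inj₂ ¬zb
  ... | yes za | yes zb = ⊥-elim (<⇒≱ (s≤s (s≤s z≤n)) (subst (2 ≤_) one-neighbour two-neighbours))
    where
    one-neighbour : ∣ T ∩ nbhd F z ∣ ≡ 1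
    one-neighbour = proj₂ (∈-tabulate-fromDec⁻ _ z z∈Val)
    neighbour : ∀ {x} → x ∈ₛ T → ShadowAdj F z x → x ∈ₛ T ∩ nbhd F z
    neighbour {x} x∈T zx = x∈p∩q⁺ (x∈T , ∈-tabulate-fromDec⁺ (shadowAdj? F z) x zx)
    two-neighbours : 2 ≤ ∣ T ∩ nbhd F z ∣
    two-neighbours = two≤∣p∣ (neighbour a∈T za) (neighbour b∈T zb) a≢b

  -- If a, b lie in a common triple and a, b, c, d span a 4-cycle of the
  -- complement of the shadow, that cycle is a-c-b-d-a: each of a, b is
  -- non-adjacent to each of c, d.
  cycle4⇒cross-nonadjacent : ∀ {T a b c d} → T ∈ F → a ∈ₛ T → b ∈ₛ T → a ≢ b →
    Cycle4 F a b c d →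
    ¬ ShadowAdj F a c × ¬ ShadowAdj F a d × ¬ ShadowAdj F b c × ¬ ShadowAdj F b d
  cycle4⇒cross-nonadjacent T∈F a∈T b∈T a≢b (inj₁ ((_ , ¬ab) , _)) =
    ⊥-elim (¬ab (triple⇒shadow F T∈F a∈T b∈T a≢b))
  cycle4⇒cross-nonadjacent T∈F a∈T b∈T a≢b (inj₂ (inj₁ ((_ , ¬ab) , _))) =
    ⊥-elim (¬ab (triple⇒shadow F T∈F a∈T b∈T a≢b))
  cycle4⇒cross-nonadjacent _ _ _ _
    (inj₂ (inj₂ ((_ , ¬ac) , (_ , ¬cb) , (_ , ¬bd) , (_ , ¬da)))) =
    ¬ac , ¬da ∘ shadow-sym F , ¬cb ∘ shadow-sym F , ¬bd

-- For triples adjacent in 𝒢 of a spreading system on more than three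
-- vertices, no vertex is counted by both Val(T) and Val(T'): it would form
-- an independent triple with a missed vertex of T and one of T'.
valSets-disjoint : ∀ {n} (F : Family n) → Spreading F → 3 < n →
  ∀ {T T'} → T ∈ F → TripleGraphAdj F T T' →
  ∀ z → z ∈ₛ ValSet F T → z ∉ₛ ValSet F T'
valSets-disjoint F spreading 3<n {T} {T'} T∈F
  (_ , a , b , c , d , a∈T , b∈T , c∈T' , d∈T' , (a≢b , a≢c , a≢d , b≢c , b≢d , c≢d) , cycle)
  z z∈Val z∈Val' =
  conclude (cycle4⇒cross-nonadjacent F T∈F a∈T b∈T a≢b cycle)
           (valSet-misses F z∈Val a∈T b∈T a≢b)
           (valSet-misses F z∈Val' c∈T' d∈T' c≢d)
  where
  independent : ∀ {x y w} → x ≢ y → x ≢ w → y ≢ w →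
    ¬ ShadowAdj F x y → ¬ ShadowAdj F x w → ¬ ShadowAdj F y w → ⊥
  independent = no-independent-triple F spreading 3<n
  z∉T : ∀ {x} → x ∈ₛ T → z ≢ x
  z∉T x∈T refl = valSet-outside F z∈Val x∈T
  z∉T' : ∀ {x} → x ∈ₛ T' → z ≢ x
  z∉T' x∈T' refl = valSet-outside F z∈Val' x∈T'
  conclude :
    ¬ ShadowAdj F a c × ¬ ShadowAdj F a d × ¬ ShadowAdj F b c × ¬ ShadowAdj F b d →
    ¬ ShadowAdj F z a ⊎ ¬ ShadowAdj F z b → ¬ ShadowAdj F z c ⊎ ¬ ShadowAdj F z d → ⊥
  conclude (¬ac , _ , _ , _) (inj₁ ¬za) (inj₁ ¬zc) = independent (z∉T a∈T) (z∉T' c∈T') a≢c ¬za ¬zc ¬ac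
  conclude (_ , ¬ad , _ , _) (inj₁ ¬za) (inj₂ ¬zd) = independent (z∉T a∈T) (z∉T' d∈T') a≢d ¬za ¬zd ¬ad
  conclude (_ , _ , ¬bc , _) (inj₂ ¬zb) (inj₁ ¬zc) = independent (z∉T b∈T) (z∉T' c∈T') b≢c ¬zb ¬zc ¬bc
  conclude (_ , _ , _ , ¬bd) (inj₂ ¬zb) (inj₂ ¬zd) = independent (z∉T b∈T) (z∉T' d∈T') b≢d ¬zb ¬zd ¬bd

proposition2 : (n : ℕ) → 5 < n → (F : Family n) → IsLinear F → Spreading F →
    (T T' : Subset n) → T ∈ F → T' ∈ F → TripleGraphAdj F T T' →
    Val F T + Val F T' ≤ n
proposition2 n 5<n F _ spreading T T' T∈F _ adj =
  disjoint⇒∣p∣+∣q∣≤n (ValSet F T) (ValSet F T')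
    (valSets-disjoint F spreading 3<n T∈F adj)
  where
  3<n : 3 < n
  3<n = ≤-trans (s≤s (s≤s (s≤s (s≤s z≤n)))) 5<n
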